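{- Let $\Gamma$ be a complete dominance graph on vertex set $\{1,\dots,n\}$ and let $L=D-A$ be its graph Laplacian. Let $V$ be the $n\times n$ matrix whose $i$th column is $\mathbf{v}_i=\sum_{k=1}^{i}\mathbf{e}_k$ ($\mathbf{e}_k$ the standard basis vectors). Then $V^{ -1}$ is the upper bidiagonal matrix with all diagonal entries equal to $1$, all superdiagonal entries equal to $-1$, and all other entries $0$. Moreover, there exists a permutation matrix $P$ such that, for $i=1,\dots,n$, the $i$th row of $V^{ -1}$ is a left eigenvector of $P^TLP$ for the eigenvalue $n-i$.
   Context: A complete dominance graph is an acyclic tournament (for each pair of distinct vertices exactly one of the two directed edges is present, and there is no directed cycle) in which every edge has weight $1$. Its graph Laplacian is $L=D-A$, where $A=[w_{ij}]$ is the weighted adjacency matrix ($w_{ij}=1$ if $(i,j)$ is an edge, $0$ otherwise) and $D$ is the diagonal matrix of out-degrees $d^+(i)=\sum_j w_{ij}$. A left eigenvector of $M$ for $\lambda$ is a nonzero row vector $\mathbf{y}$ with $\mathbf{y}M=\lambda\mathbf{y}$. -}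

module Defs where

open import Data.Nat using (ℕ; zero; suc; _≤ᵇ_; _∸_)
open import Data.Integer using (ℤ; +_; -_; _+_; _-_; _*_; 0ℤ; 1ℤ)
open import Data.Fin using (Fin; toℕ; _≟_)
open import Data.Fin.Permutation using (Permutation′; _⟨$⟩ʳ_)
open import Data.Bool using (Bool; true; false; if_then_else_)
open import Data.Product using (_×_; ∃)
open import Data.Sum using (_⊎_)
open import Relation.Nullary using (¬_; does)
open import Relation.Binary.PropositionalEquality using (_≡_; _≢_)
open import Relation.Binary.Construct.Closure.Transitive using (TransClosure)
import Data.Nat as ℕ

-- square integer matrices of size n, indexed by Fin n (0-based)
Matrix : ℕ → Set
Matrix n = Fin n → Fin n → ℤ

∑ : ∀ {n} → (Fin n → ℤ) → ℤ
∑ {zero}  f = 0ℤ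
∑ {suc n} f = f Fin.zero + ∑ (λ k → f (Fin.suc k))
  where import Data.Fin as Fin

_⊗_ : ∀ {n} → Matrix n → Matrix n → Matrix n
(M ⊗ N) i j = ∑ (λ k → M i k * N k j)

transpose : ∀ {n} → Matrix n → Matrix n
transpose M i j = M j i

δ : ∀ {n} → Fin n → Fin n → ℤ
δ i j = if does (i ≟ j) then 1ℤ else 0ℤ

identity : ∀ {n} → Matrix n
identity = δ

IsInverseOf : ∀ {n} → Matrix n → Matrix n → Set
IsInverseOf M N = (∀ i j → (M ⊗ N) i j ≡ identity i j) × (∀ i j → (N ⊗ M) i j ≡ identity i j)

permMatrix : ∀ {n} → Permutation′ n → Matrix n
permMatrix σ i j = δ i (σ ⟨$⟩ʳ j)

Edge : ∀ {n} → (Fin n → Fin n → Bool) → Fin n → Fin n → Set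
Edge E i j = E i j ≡ true

IsTournament : ∀ {n} → (Fin n → Fin n → Bool) → Set
IsTournament {n} E = ∀ (i j : Fin n) → i ≢ j →
  (E i j ≡ true × E j i ≡ false) ⊎ (E i j ≡ false × E j i ≡ true)

IsAcyclic : ∀ {n} → (Fin n → Fin n → Bool) → Set
IsAcyclic {n} E = ∀ (i : Fin n) → ¬ TransClosure (Edge E) i i

IsCompleteDominanceGraph : ∀ {n} → (Fin n → Fin n → Bool) → Set
IsCompleteDominanceGraph E = IsTournament E × IsAcyclic E

adjacency : ∀ {n} → (Fin n → Fin n → Bool) → Matrix n
adjacency E i j = if E i j then 1ℤ else 0ℤ

outDegree : ∀ {n} → (Fin n → Fin n → Bool) → Fin n → ℤ
outDegree E i = ∑ (λ j → adjacency E i j)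

degreeMatrix : ∀ {n} → (Fin n → Fin n → Bool) → Matrix n
degreeMatrix E i j = δ i j * outDegree E i

laplacian : ∀ {n} → (Fin n → Fin n → Bool) → Matrix n
laplacian E i j = degreeMatrix E i j - adjacency E i j

-- V: column j is v_j = e_0 + ... + e_j, so V i j = 1 iff i ≤ j
Vmat : ∀ {n} → Matrix n
Vmat i j = if toℕ i ≤ᵇ toℕ j then 1ℤ else 0ℤ

Bidiag : ∀ {n} → Matrix n
Bidiag i j = if does (i ≟ j) then 1ℤ
             else (if does (suc (toℕ i) ℕ.≟ toℕ j) then - 1ℤ else 0ℤ)

IsLeftEigenvector : ∀ {n} → Matrix n → ℤ → (Fin n → ℤ) → Set
IsLeftEigenvector M λ' y = (∃ λ k → y k ≢ 0ℤ) × (∀ j → ∑ (λ k → y k * M k j) ≡ λ' * y j)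

-- Bidiag is the difference operator y ↦ y_i − y_{i+1} on rows, and V is its
-- summation inverse. In a complete dominance graph the out-neighbourhood of the
-- head of an edge is strictly contained in that of its tail, so out-degrees are
-- distinct and listing the vertices by decreasing out-degree n−1, …, 0 makes
-- PᵀLP upper triangular with diagonal n−1−a and −1 above it. Subtracting
-- consecutive rows of that matrix gives (n−1−i)(e_i − e_{i+1}).
module Submission where

open import Defs
open import Data.Nat as ℕ using (ℕ; zero; suc; _∸_; _<_; _<?_; _≤ᵇ_; s<s)
import Data.Nat.Properties as ℕ
open import Data.Integer as ℤ using (ℤ; +_; -_; _+_; _-_; _*_; _⊖_; 0ℤ; 1ℤ)
import Data.Integer.Properties as ℤ
open import Data.Integer.Tactic.RingSolver using (solve-∀)
open import Data.Fin using (Fin; zero; suc; toℕ; fromℕ<; opposite; punchOut; _≟_)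
open import Data.Fin.Properties
  using (toℕ<n; toℕ-injective; toℕ-fromℕ<; opposite-prop; any?; punchOut-injective; injective⇒≤)
open import Data.Fin.Permutation
  using (Permutation′; permutation; _⟨$⟩ʳ_; _⟨$⟩ˡ_; _∘ₚ_; flip; reverse; inverseˡ; inverseʳ)
open import Data.Fin.Subset using (Subset; _∈_; _∉_; ∣_∣)
open import Data.Fin.Subset.Properties using (p⊂q⇒∣p∣<∣q∣; ∈⊤; ∣⊤∣≡n)
open import Data.Vec using (tabulate)
open import Data.Vec.Properties using (lookup∘tabulate; []=⇒lookup; lookup⇒[]=)
open import Data.Bool using (Bool; true; false; if_then_else_)
open import Data.Product using (∃; _×_; _,_; proj₁; proj₂)
open import Data.Sum using (inj₁; inj₂)
open import Data.Empty using (⊥-elim)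
open import Function using (_∘_; _⇔_; mk⇔; Equivalence)
open import Function.Definitions using (Injective)
open import Relation.Nullary using (Dec; yes; no; does; contradiction)
open import Relation.Nullary.Decidable using (dec-true; dec-false; does-⇔)
open import Relation.Binary.PropositionalEquality
open import Relation.Binary.Construct.Closure.Transitive using ([_]; _∷_)
open ≡-Reasoning

𝟙 : Bool → ℤ
𝟙 b = if b then 1ℤ else 0ℤ

≡does : ∀ {p} {P : Set p} {b : Bool} (P? : Dec P) → (b ≡ true ⇔ P) → b ≡ does P?
≡does {b = true}  P? b⇔P = sym (dec-true P? (Equivalence.to b⇔P refl))
≡does {b = false} P? b⇔P = sym (dec-false P? λ p → contradiction (Equivalence.from b⇔P p) λ ())

∑-cong : ∀ {n} {f g : Fin n → ℤ} → (∀ k → f k ≡ g k) → ∑ f ≡ ∑ g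
∑-cong {zero}  f≗g = refl
∑-cong {suc n} f≗g = cong₂ _+_ (f≗g zero) (∑-cong (f≗g ∘ suc))

∑-zero : ∀ {n} {f : Fin n → ℤ} → (∀ k → f k ≡ 0ℤ) → ∑ f ≡ 0ℤ
∑-zero {zero}  f≗0 = refl
∑-zero {suc n} f≗0 = cong₂ _+_ (f≗0 zero) (∑-zero (f≗0 ∘ suc))

∑-δˡ : ∀ {n} (j : Fin n) (f : Fin n → ℤ) → ∑ (λ k → δ k j * f k) ≡ f j
∑-δˡ zero f = begin
  1ℤ * f zero + ∑ (λ k → 0ℤ * f (suc k)) ≡⟨ cong₂ _+_ (ℤ.*-identityˡ (f zero)) (∑-zero (λ k → ℤ.*-zeroˡ (f (suc k)))) ⟩
  f zero + 0ℤ                            ≡⟨ ℤ.+-identityʳ _ ⟩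
  f zero                                 ∎
∑-δˡ (suc j) f = begin
  0ℤ * f zero + ∑ (λ k → δ k j * f (suc k)) ≡⟨ cong₂ _+_ (ℤ.*-zeroˡ (f zero)) (∑-δˡ j (f ∘ suc)) ⟩
  0ℤ + f (suc j)                            ≡⟨ ℤ.+-identityˡ _ ⟩
  f (suc j)                                 ∎

∑-δʳ : ∀ {n} (j : Fin n) (f : Fin n → ℤ) → ∑ (λ k → f k * δ k j) ≡ f j
∑-δʳ j f = trans (∑-cong λ k → ℤ.*-comm (f k) (δ k j)) (∑-δˡ j f)

permMatrix-conjugate : ∀ {n} (σ : Permutation′ n) (M : Matrix n) a b →
  (transpose (permMatrix σ) ⊗ (M ⊗ permMatrix σ)) a b ≡ M (σ ⟨$⟩ʳ a) (σ ⟨$⟩ʳ b)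
permMatrix-conjugate σ M a b = begin
  ∑ (λ k → δ k (σ ⟨$⟩ʳ a) * ∑ (λ l → M k l * δ l (σ ⟨$⟩ʳ b)))
    ≡⟨ ∑-cong (λ k → cong (δ k (σ ⟨$⟩ʳ a) *_) (∑-δʳ (σ ⟨$⟩ʳ b) (M k))) ⟩
  ∑ (λ k → δ k (σ ⟨$⟩ʳ a) * M k (σ ⟨$⟩ʳ b))
    ≡⟨ ∑-δˡ (σ ⟨$⟩ʳ a) (λ k → M k (σ ⟨$⟩ʳ b)) ⟩
  M (σ ⟨$⟩ʳ a) (σ ⟨$⟩ʳ b) ∎

-- Vectors are indexed by ℕ here, so that the entry following the last one is f n.

∑-Bidiag-row : ∀ {n} (f : ℕ → ℤ) → f n ≡ 0ℤ → (i : Fin n) →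
  ∑ (λ k → Bidiag i k * f (toℕ k)) ≡ f (toℕ i) - f (suc (toℕ i))
∑-Bidiag-row {suc n} f fn≡0 zero = cong₂ _+_ (ℤ.*-identityˡ (f 0)) (∑-Bidiag-zero-suc n (f ∘ suc) fn≡0)
  where
  ∑-Bidiag-zero-suc : ∀ n (g : ℕ → ℤ) → g n ≡ 0ℤ →
    ∑ (λ k → Bidiag {suc n} zero (suc k) * g (toℕ k)) ≡ - g 0
  ∑-Bidiag-zero-suc zero    g g0≡0 = sym (cong -_ g0≡0)
  ∑-Bidiag-zero-suc (suc n) g _    = begin
    - 1ℤ * g 0 + ∑ {n} (λ k → 0ℤ * g (suc (toℕ k)))
      ≡⟨ cong₂ _+_ (ℤ.-1*i≡-i (g 0)) (∑-zero {n} (λ k → ℤ.*-zeroˡ (g (suc (toℕ k))))) ⟩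
    - g 0 + 0ℤ                                   ≡⟨ ℤ.+-identityʳ _ ⟩
    - g 0                                        ∎
∑-Bidiag-row {suc n} f fn≡0 (suc i) = begin
  0ℤ * f 0 + ∑ (λ k → Bidiag i k * f (suc (toℕ k))) ≡⟨ cong₂ _+_ (ℤ.*-zeroˡ (f 0)) (∑-Bidiag-row (f ∘ suc) fn≡0 i) ⟩
  0ℤ + (f (suc (toℕ i)) - f (suc (suc (toℕ i))))    ≡⟨ ℤ.+-identityˡ _ ⟩
  f (suc (toℕ i)) - f (suc (suc (toℕ i)))           ∎

∑-Bidiag-col-zero : ∀ {n} (f : ℕ → ℤ) → ∑ (λ k → f (toℕ k) * Bidiag {suc n} k zero) ≡ f 0
∑-Bidiag-col-zero {n} f = begin
  f 0 * 1ℤ + ∑ {n} (λ k → f (suc (toℕ k)) * 0ℤ)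
    ≡⟨ cong₂ _+_ (ℤ.*-identityʳ (f 0)) (∑-zero {n} (λ k → ℤ.*-zeroʳ (f (suc (toℕ k))))) ⟩
  f 0 + 0ℤ                                   ≡⟨ ℤ.+-identityʳ _ ⟩
  f 0                                        ∎

∑-Bidiag-col-suc : ∀ {n} (f : ℕ → ℤ) (j : Fin n) →
  ∑ (λ k → f (toℕ k) * Bidiag k (suc j)) ≡ f (suc (toℕ j)) - f (toℕ j)
∑-Bidiag-col-suc {suc n} f zero = begin
  f 0 * - 1ℤ + ∑ {suc n} (λ k → f (suc (toℕ k)) * Bidiag k zero)
    ≡⟨ cong (λ x → f 0 * - 1ℤ + x) (∑-Bidiag-col-zero {n} (f ∘ suc)) ⟩
  f 0 * - 1ℤ + f 1                                        ≡⟨ shift (f 0) (f 1) ⟩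
  f 1 - f 0                                               ∎
  where
  shift : ∀ x y → x * - 1ℤ + y ≡ y - x
  shift = solve-∀
∑-Bidiag-col-suc {suc n} f (suc j) = begin
  f 0 * 0ℤ + ∑ {suc n} (λ k → f (suc (toℕ k)) * Bidiag k (suc j))
    ≡⟨ cong₂ _+_ (ℤ.*-zeroʳ (f 0)) (∑-Bidiag-col-suc (f ∘ suc) j) ⟩
  0ℤ + (f (suc (suc (toℕ j))) - f (suc (toℕ j)))           ≡⟨ ℤ.+-identityˡ _ ⟩
  f (suc (suc (toℕ j))) - f (suc (toℕ j))                  ∎

Vmatℕ : ℕ → ℕ → ℤ
Vmatℕ a b = 𝟙 (a ≤ᵇ b)

Vmatℕ-suc : ∀ a b → Vmatℕ (suc a) (suc b) ≡ Vmatℕ a b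
Vmatℕ-suc zero    b = refl
Vmatℕ-suc (suc a) b = refl

Vmatℕ-last : ∀ {n} (j : Fin n) → Vmatℕ n (toℕ j) ≡ 0ℤ
Vmatℕ-last zero    = refl
Vmatℕ-last {suc n} (suc j) = trans (Vmatℕ-suc n (toℕ j)) (Vmatℕ-last j)

Vmatℕ-row-diff : ∀ {n} (i j : Fin n) → Vmatℕ (toℕ i) (toℕ j) - Vmatℕ (suc (toℕ i)) (toℕ j) ≡ δ i j
Vmatℕ-row-diff zero    zero    = refl
Vmatℕ-row-diff zero    (suc j) = refl
Vmatℕ-row-diff (suc i) zero    = refl
Vmatℕ-row-diff (suc i) (suc j) =
  trans (cong₂ _-_ (Vmatℕ-suc (toℕ i) (toℕ j)) (Vmatℕ-suc (suc (toℕ i)) (toℕ j))) (Vmatℕ-row-diff i j)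

Vmatℕ-col-zero : ∀ {n} (i : Fin (suc n)) → Vmatℕ (toℕ i) 0 ≡ δ i zero
Vmatℕ-col-zero zero    = refl
Vmatℕ-col-zero (suc i) = refl

Vmatℕ-col-diff : ∀ {n} (i : Fin (suc n)) (j : Fin n) →
  Vmatℕ (toℕ i) (suc (toℕ j)) - Vmatℕ (toℕ i) (toℕ j) ≡ δ i (suc j)
Vmatℕ-col-diff zero          j       = refl
Vmatℕ-col-diff (suc zero)    zero    = refl
Vmatℕ-col-diff (suc (suc i)) zero    = refl
Vmatℕ-col-diff (suc i)       (suc j) =
  trans (cong₂ _-_ (Vmatℕ-suc (toℕ i) (suc (toℕ j))) (Vmatℕ-suc (toℕ i) (toℕ j))) (Vmatℕ-col-diff i j)

Bidiag-inverse : ∀ {n} → IsInverseOf Bidiag (Vmat {n})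
Bidiag-inverse = BV≡I , VB≡I
  where
  BV≡I : ∀ {n} (i j : Fin n) → (Bidiag ⊗ Vmat) i j ≡ identity i j
  BV≡I i j = trans (∑-Bidiag-row (λ k → Vmatℕ k (toℕ j)) (Vmatℕ-last j) i) (Vmatℕ-row-diff i j)

  VB≡I : ∀ {n} (i j : Fin n) → (Vmat ⊗ Bidiag) i j ≡ identity i j
  VB≡I {suc n} i zero    = trans (∑-Bidiag-col-zero {n} (Vmatℕ (toℕ i))) (Vmatℕ-col-zero i)
  VB≡I {suc n} i (suc j) = trans (∑-Bidiag-col-suc (Vmatℕ (toℕ i)) j) (Vmatℕ-col-diff i j)

-- The Laplacian of the transitive tournament a → b ⇔ a < b, where vertex a has out-degree d a.
transitiveLaplacian : (ℕ → ℤ) → ℕ → ℕ → ℤ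
transitiveLaplacian d a b = 𝟙 (does (a ℕ.≟ b)) * d a - 𝟙 (does (a <? b))

transitiveLaplacian-last : ∀ {n} (d : ℕ → ℤ) (j : Fin n) → transitiveLaplacian d n (toℕ j) ≡ 0ℤ
transitiveLaplacian-last d zero    = refl
transitiveLaplacian-last d (suc j) = transitiveLaplacian-last (d ∘ suc) j

transitiveLaplacian-row-diff : ∀ {n} (d : ℕ → ℤ) (i j : Fin n) → d (toℕ i) ≡ d (suc (toℕ i)) + 1ℤ →
  transitiveLaplacian d (toℕ i) (toℕ j) - transitiveLaplacian d (suc (toℕ i)) (toℕ j)
    ≡ d (toℕ i) * Bidiag i j
transitiveLaplacian-row-diff d zero zero _ = diagonal (d 0) (d 1)
  where
  diagonal : ∀ x y → (1ℤ * x - 0ℤ) - (0ℤ * y - 0ℤ) ≡ x * 1ℤ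
  diagonal = solve-∀
transitiveLaplacian-row-diff d zero (suc zero) d₀≡d₁+1 = begin
  (0ℤ * d 0 - 1ℤ) - (1ℤ * d 1 - 0ℤ) ≡⟨ superdiagonal (d 1) ⟩
  (d 1 + 1ℤ) * - 1ℤ                 ≡⟨ cong (_* - 1ℤ) d₀≡d₁+1 ⟨
  d 0 * - 1ℤ                        ∎
  where
  superdiagonal : ∀ y → (0ℤ * d 0 - 1ℤ) - (1ℤ * y - 0ℤ) ≡ (y + 1ℤ) * - 1ℤ
  superdiagonal = solve-∀
transitiveLaplacian-row-diff d zero (suc (suc j)) _ = above (d 0) (d 1)
  where
  above : ∀ x y → (0ℤ * x - 1ℤ) - (0ℤ * y - 1ℤ) ≡ x * 0ℤ
  above = solve-∀
transitiveLaplacian-row-diff d (suc i) zero _ = below (d (suc (toℕ i))) (d (suc (suc (toℕ i))))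
  where
  below : ∀ x y → (0ℤ * x - 0ℤ) - (0ℤ * y - 0ℤ) ≡ x * 0ℤ
  below = solve-∀
transitiveLaplacian-row-diff d (suc i) (suc j) dᵢ≡dᵢ₊₁+1 =
  transitiveLaplacian-row-diff (d ∘ suc) i j dᵢ≡dᵢ₊₁+1

Bidiag-rows-eigen : ∀ {n} (d : ℕ → ℤ) → (∀ a → d a ≡ d (suc a) + 1ℤ) → (i j : Fin n) →
  ∑ (λ k → Bidiag i k * transitiveLaplacian d (toℕ k) (toℕ j)) ≡ d (toℕ i) * Bidiag i j
Bidiag-rows-eigen d d-step i j =
  trans (∑-Bidiag-row (λ k → transitiveLaplacian d k (toℕ j)) (transitiveLaplacian-last d j) i)
        (transitiveLaplacian-row-diff d i j (d-step (toℕ i)))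

∑-𝟙≡∣tabulate∣ : ∀ {n} (f : Fin n → Bool) → ∑ (λ j → 𝟙 (f j)) ≡ + ∣ tabulate f ∣
∑-𝟙≡∣tabulate∣ {zero}  f = refl
∑-𝟙≡∣tabulate∣ {suc n} f with f zero
... | true  = cong ℤ.suc (∑-𝟙≡∣tabulate∣ (f ∘ suc))
... | false = cong (λ x → 0ℤ + x) (∑-𝟙≡∣tabulate∣ (f ∘ suc))

module _ {n} (E : Fin n → Fin n → Bool) where

  edge-irreflexive : IsAcyclic E → ∀ u → E u u ≡ false
  edge-irreflexive acyclic u with E u u in uu
  ... | true  = ⊥-elim (acyclic u [ uu ])
  ... | false = refl

  edge-transitive : IsCompleteDominanceGraph E → ∀ {u v w} → E u v ≡ true → E v w ≡ true → E u w ≡ true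
  edge-transitive (tournament , acyclic) {u} {v} {w} uv vw with u ≟ w
  ... | yes refl = ⊥-elim (acyclic u (uv ∷ [ vw ]))
  ... | no u≢w with tournament u w u≢w
  ...   | inj₁ (uw , _) = uw
  ...   | inj₂ (_ , wu) = ⊥-elim (acyclic u (uv ∷ vw ∷ [ wu ]))

  outNeighbours : Fin n → Subset n
  outNeighbours u = tabulate (E u)

  ∈-outNeighbours⁺ : ∀ {u v} → E u v ≡ true → v ∈ outNeighbours u
  ∈-outNeighbours⁺ {u} {v} uv = lookup⇒[]= v (outNeighbours u) (trans (lookup∘tabulate (E u) v) uv)

  ∈-outNeighbours⁻ : ∀ {u v} → v ∈ outNeighbours u → E u v ≡ true
  ∈-outNeighbours⁻ {u} {v} v∈ = trans (sym (lookup∘tabulate (E u) v)) ([]=⇒lookup v∈)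

  score : Fin n → ℕ
  score u = ∣ outNeighbours u ∣

  outDegree≡score : ∀ u → outDegree E u ≡ + score u
  outDegree≡score u = ∑-𝟙≡∣tabulate∣ (E u)

  ∉-outNeighbours-self : IsAcyclic E → ∀ u → u ∉ outNeighbours u
  ∉-outNeighbours-self acyclic u u∈ with () ← trans (sym (∈-outNeighbours⁻ u∈)) (edge-irreflexive acyclic u)

  score<n : IsAcyclic E → ∀ u → score u < n
  score<n acyclic u = subst (score u <_) (∣⊤∣≡n n)
    (p⊂q⇒∣p∣<∣q∣ ((λ _ → ∈⊤) , u , ∈⊤ , ∉-outNeighbours-self acyclic u))

  edge⇒score> : IsCompleteDominanceGraph E → ∀ {u v} → E u v ≡ true → score v < score u
  edge⇒score> G@(_ , acyclic) {v = v} uv = p⊂q⇒∣p∣<∣q∣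
    ( (λ w∈ → ∈-outNeighbours⁺ (edge-transitive G uv (∈-outNeighbours⁻ w∈)))
    , v , ∈-outNeighbours⁺ uv , ∉-outNeighbours-self acyclic v)

  edge⇔score> : IsCompleteDominanceGraph E → ∀ {u v} → E u v ≡ true ⇔ score v < score u
  edge⇔score> G@(tournament , _) {u} {v} = mk⇔ (edge⇒score> G) score>⇒edge
    where
    score>⇒edge : score v < score u → E u v ≡ true
    score>⇒edge v<u with tournament u v (λ { refl → ℕ.<-irrefl refl v<u })
    ... | inj₁ (uv , _) = uv
    ... | inj₂ (_ , vu) = contradiction (edge⇒score> G vu) (ℕ.<-asym v<u)

  score-injective : IsCompleteDominanceGraph E → Injective _≡_ _≡_ score
  score-injective G@(tournament , _) {u} {v} su≡sv with u ≟ v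
  ... | yes u≡v = u≡v
  ... | no u≢v with tournament u v u≢v
  ...   | inj₁ (uv , _) = contradiction (sym su≡sv) (ℕ.<⇒≢ (edge⇒score> G uv))
  ...   | inj₂ (_ , vu) = contradiction su≡sv (ℕ.<⇒≢ (edge⇒score> G vu))

injective⇒surjective : ∀ {n} {f : Fin n → Fin n} → Injective _≡_ _≡_ f → ∀ y → ∃ λ x → f x ≡ y
injective⇒surjective {suc n} {f} f-injective y with any? (λ x → f x ≟ y)
... | yes hit  = hit
... | no  miss = contradiction (injective⇒≤ punchOut-y∘f-injective) ℕ.1+n≰n
  where
  y≢f : ∀ x → y ≢ f x
  y≢f x y≡fx = miss (x , sym y≡fx)

  punchOut-y∘f-injective : Injective _≡_ _≡_ (λ x → punchOut (y≢f x))
  punchOut-y∘f-injective eq = f-injective (punchOut-injective (y≢f _) (y≢f _) eq)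

injective⇒permutation : ∀ {n} (f : Fin n → Fin n) → Injective _≡_ _≡_ f → Permutation′ n
injective⇒permutation f f-injective = permutation f (proj₁ ∘ surjective) (proj₂ ∘ surjective)
  (λ x → f-injective (proj₂ (surjective (f x))))
  where surjective = injective⇒surjective f-injective

⊖-suc : ∀ n a → n ⊖ suc a ≡ n ⊖ suc (suc a) + 1ℤ
⊖-suc n a = begin
  n ⊖ suc a                ≡⟨ ℤ.[1+m]⊖[1+n]≡m⊖n n (suc a) ⟨
  suc n ⊖ suc (suc a)      ≡⟨ cong (_⊖ suc (suc a)) (ℕ.+-comm 1 n) ⟩
  n ℕ.+ 1 ⊖ suc (suc a)    ≡⟨ ℤ.distribˡ-⊖-+-pos 1 n (suc (suc a)) ⟨
  n ⊖ suc (suc a) + 1ℤ     ∎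

module _ {n} (E : Fin n → Fin n → Bool) (G : IsCompleteDominanceGraph E) where

  scoreFin : Fin n → Fin n
  scoreFin u = fromℕ< (score<n E (proj₂ G) u)

  scoreFin-injective : Injective _≡_ _≡_ scoreFin
  scoreFin-injective {u} {v} eq = score-injective E G
    (trans (sym (toℕ-fromℕ< _)) (trans (cong toℕ eq) (toℕ-fromℕ< _)))

  byScore : Permutation′ n
  byScore = injective⇒permutation scoreFin scoreFin-injective

  byDecreasingScore : Permutation′ n
  byDecreasingScore = reverse ∘ₚ flip byScore

  private
    σ : Fin n → Fin n
    σ a = byDecreasingScore ⟨$⟩ʳ a

  score-byDecreasingScore : ∀ a → score E (σ a) ≡ n ∸ suc (toℕ a)
  score-byDecreasingScore a = begin
    score E (σ a)                                ≡⟨ toℕ-fromℕ< _ ⟨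
    toℕ (byScore ⟨$⟩ʳ (byScore ⟨$⟩ˡ opposite a)) ≡⟨ cong toℕ (inverseʳ byScore) ⟩
    toℕ (opposite a)                             ≡⟨ opposite-prop a ⟩
    n ∸ suc (toℕ a)                              ∎

  edge-byDecreasingScore : ∀ a b → E (σ a) (σ b) ≡ does (toℕ a <? toℕ b)
  edge-byDecreasingScore a b = ≡does (toℕ a <? toℕ b) (mk⇔
    (λ e → ℕ.s<s⁻¹ (ℕ.∸-cancelʳ-< {o = n}
             (subst₂ _<_ (score-byDecreasingScore b) (score-byDecreasingScore a)
                     (Equivalence.to (edge⇔score> E G) e))))
    (λ a<b → Equivalence.from (edge⇔score> E G)
               (subst₂ _<_ (sym (score-byDecreasingScore b)) (sym (score-byDecreasingScore a))
                       (ℕ.∸-monoʳ-< {m = n} (s<s a<b) (toℕ<n b)))))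

  δ-byDecreasingScore : ∀ a b → δ (σ a) (σ b) ≡ 𝟙 (does (toℕ a ℕ.≟ toℕ b))
  δ-byDecreasingScore a b = cong 𝟙 (does-⇔ σa≡σb⇔a≡b (σ a ≟ σ b) (toℕ a ℕ.≟ toℕ b))
    where
    σ-injective : Injective _≡_ _≡_ σ
    σ-injective eq = trans (sym (inverseˡ byDecreasingScore))
                           (trans (cong (byDecreasingScore ⟨$⟩ˡ_) eq) (inverseˡ byDecreasingScore))

    σa≡σb⇔a≡b : σ a ≡ σ b ⇔ toℕ a ≡ toℕ b
    σa≡σb⇔a≡b = mk⇔ (λ eq → cong toℕ (σ-injective eq)) (λ eq → cong σ (toℕ-injective eq))

  laplacian-byDecreasingScore : ∀ a b →
    (transpose (permMatrix byDecreasingScore) ⊗ (laplacian E ⊗ permMatrix byDecreasingScore)) a b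
      ≡ transitiveLaplacian (λ c → n ⊖ suc c) (toℕ a) (toℕ b)
  laplacian-byDecreasingScore a b = begin
    _ ≡⟨ permMatrix-conjugate byDecreasingScore (laplacian E) a b ⟩
    δ (σ a) (σ b) * outDegree E (σ a) - 𝟙 (E (σ a) (σ b))
      ≡⟨ cong₂ _-_ (cong₂ _*_ (δ-byDecreasingScore a b) outDegree-σ) (cong 𝟙 (edge-byDecreasingScore a b)) ⟩
    transitiveLaplacian (λ c → n ⊖ suc c) (toℕ a) (toℕ b) ∎
    where
    outDegree-σ : outDegree E (σ a) ≡ n ⊖ suc (toℕ a)
    outDegree-σ = begin
      outDegree E (σ a)   ≡⟨ outDegree≡score E (σ a) ⟩
      + score E (σ a)     ≡⟨ cong +_ (score-byDecreasingScore a) ⟩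
      + (n ∸ suc (toℕ a)) ≡⟨ ℤ.⊖-≥ (toℕ<n a) ⟨
      n ⊖ suc (toℕ a)     ∎

Bidiag-diagonal : ∀ {n} (i : Fin n) → Bidiag i i ≡ 1ℤ
Bidiag-diagonal i rewrite dec-true (i ≟ i) refl = refl

proposition3p3 : (n : ℕ) (E : Fin n → Fin n → Bool) → IsCompleteDominanceGraph E →
    IsInverseOf Bidiag (Vmat {n})
    × ∃ λ (σ : Permutation′ n) → ∀ (i : Fin n) →
        IsLeftEigenvector (transpose (permMatrix σ) ⊗ (laplacian E ⊗ permMatrix σ))
          (+ (n ∸ suc (toℕ i))) (Bidiag i)
proposition3p3 n E G = Bidiag-inverse , byDecreasingScore E G , λ i → (i , Bidiag-i≢0 i) , eigen i
  where
  Bidiag-i≢0 : ∀ i → Bidiag i i ≢ 0ℤ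
  Bidiag-i≢0 i eq with () ← trans (sym (Bidiag-diagonal i)) eq

  eigen : ∀ i j → ∑ (λ k → Bidiag i k * (transpose (permMatrix (byDecreasingScore E G))
                                           ⊗ (laplacian E ⊗ permMatrix (byDecreasingScore E G))) k j)
                  ≡ + (n ∸ suc (toℕ i)) * Bidiag i j
  eigen i j = begin
    _ ≡⟨ ∑-cong (λ k → cong (Bidiag i k *_) (laplacian-byDecreasingScore E G k j)) ⟩
    ∑ (λ k → Bidiag i k * transitiveLaplacian (λ c → n ⊖ suc c) (toℕ k) (toℕ j))
      ≡⟨ Bidiag-rows-eigen (λ c → n ⊖ suc c) (⊖-suc n) i j ⟩
    (n ⊖ suc (toℕ i)) * Bidiag i j
      ≡⟨ cong (_* Bidiag i j) (ℤ.⊖-≥ (toℕ<n i)) ⟩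
    + (n ∸ suc (toℕ i)) * Bidiag i j ∎
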